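{- For every positive integer $n$, \[\sigma\overline{\mathrm{mex}}(n) \equiv \begin{cases} 1 \pmod 2, & \text{if } n=\tfrac{j(j+1)}{2} \text{ for some } j\in\mathbb{N},\\ 0 \pmod 2, & \text{otherwise.}\end{cases}\]
   Context: An overpartition of $n$ is a non-increasing sequence of positive integers summing to $n$ in which the first occurrence of each distinct part may be overlined. For an overpartition $\pi$, $\overline{\mathrm{mex}}(\pi)$ is the smallest positive integer that does not occur among the non-overlined parts of $\pi$. For a positive integer $n$, $\sigma\overline{\mathrm{mex}}(n)=\sum_{\pi}\overline{\mathrm{mex}}(\pi)$, the sum over all overpartitions $\pi$ of $n$. -}

module Defs where

open import Data.Nat using (ℕ; zero; suc; _+_; _∸_; _≡ᵇ_; _≤ᵇ_)
open import Data.Bool using (Bool; true; false; _∧_; _∨_; not)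
open import Data.Product using (_×_; _,_)
open import Data.List using (List; []; _∷_; map; concatMap; filterᵇ; upTo)
open import Data.Bool.ListAction using (any)
open import Data.Nat.ListAction using (sum)

-- A part of an overpartition: (value , overlined?)
Part : Set
Part = ℕ × Bool

-- seqs f bound m : all sequences of parts (v , b) with 1 ≤ v ≤ bound, values
-- non-increasing, summing to m (fuel f ≥ m suffices since each part is ≥ 1).
-- Every such sequence occurs exactly once.
seqs : ℕ → ℕ → ℕ → List (List Part)
seqs zero    bound zero    = [] ∷ []
seqs zero    bound (suc m) = []
seqs (suc f) bound zero    = [] ∷ []
seqs (suc f) bound (suc m) =
  concatMap (λ k → concatMap (λ b → map ((suc k , b) ∷_) (seqs f (suc k) (suc m ∸ suc k)))
                             (false ∷ true ∷ []))
            (filterᵇ (λ k → (suc k ≤ᵇ bound) ∧ (suc k ≤ᵇ suc m)) (upTo (suc m)))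

-- Overline condition: only the first occurrence of a value may be overlined,
-- i.e. an overlined part (v , true) is never preceded by another part of value v.
overlineOK : List ℕ → List Part → Bool
overlineOK seen []              = true
overlineOK seen ((v , false) ∷ π) = overlineOK (v ∷ seen) π
overlineOK seen ((v , true)  ∷ π) = not (any (v ≡ᵇ_) seen) ∧ overlineOK (v ∷ seen) π

overpartitions : ℕ → List (List Part)
overpartitions n = filterᵇ (overlineOK []) (seqs n n n)

occursNonOver : ℕ → List Part → Bool
occursNonOver k []                = false
occursNonOver k ((v , false) ∷ π) = (k ≡ᵇ v) ∨ occursNonOver k π
occursNonOver k ((v , true)  ∷ π) = occursNonOver k π

-- smallest k ≥ start not occurring among the non-overlined parts (fuel-bounded
-- search; fuel = length π + 1 always suffices).
mexFrom : ℕ → ℕ → List Part → ℕ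
mexFrom zero    k π = k
mexFrom (suc f) k π with occursNonOver k π
... | true  = mexFrom f (suc k) π
... | false = k

omex : List Part → ℕ
omex π = mexFrom (suc (Data.List.length π)) 1 π

σomex : ℕ → ℕ
σomex n = sum (map omex (overpartitions n))

-- Work modulo 2 and pair each overpartition v ∷ ρ (v its largest part) with the one obtained by
-- toggling the overline on v. The two have the same mex unless the mex of ρ is exactly v, in
-- which case the non-overlined copy has mex v + 1; so the sum is congruent to the number of
-- pairs (v , ρ) with mex ρ = v. Such a ρ contains 1, …, v − 1 but not v (non-overlined by the
-- mex, overlined because v has already occurred), so its largest part is v − 1, and toggling
-- that overline leaves exactly the tails of mex v − 1. Descending to v = 1, the number of pairs
-- with a given v is odd exactly when n = v + (v − 1) + ⋯ + 1, and at most one v qualifies.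
module Submission where

open import Defs
open import Data.Nat using (ℕ; zero; suc; _+_; _*_; _∸_; _%_; _≡ᵇ_; _≤ᵇ_; _<ᵇ_; _≤_; _<_; _≟_; _<?_; s≤s; z≤n)
open import Data.Nat.Properties
open import Data.Bool using (Bool; true; false; not; _∧_; _∨_; _xor_; if_then_else_; T)
open import Data.Bool.Properties
  using (∧-distribˡ-xor; ∧-zeroʳ; ∧-identityʳ; ∧-idem; ∧-assoc; xor-assoc; xor-same; xor-identityʳ;
         xor-inverseˡ; true-xor; not-involutive; not-distribˡ-xor; T-∧; xor-∧-commutativeRing)
open import Data.Bool.ListAction using (any)
open import Data.Nat.ListAction using (sum)
open import Data.List using (List; []; _∷_; _++_; map; concatMap; filterᵇ; upTo; length)
open import Data.List.Properties using (applyUpTo-∷ʳ)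
open import Data.List.Relation.Unary.All as All using (All; []; _∷_)
open import Data.List.Relation.Unary.All.Properties using (map⁺; concat⁺; all-filter)
open import Data.Product using (_×_; _,_; proj₁; ∃-syntax)
open import Data.Sum using (inj₁; inj₂)
open import Data.Empty using (⊥-elim)
open import Function using (_∘_; id; mk⇔; Equivalence)
open import Relation.Nullary using (¬_; Dec; yes; no)
open import Relation.Nullary.Decidable using (T?; dec-true; dec-false; does-⇔)
open import Relation.Binary.Definitions using (tri<; tri≈; tri>)
open import Relation.Binary.PropositionalEquality
open import Algebra.Bundles using (CommutativeRing)
open import Algebra.Properties.CommutativeSemigroup
  (CommutativeRing.+-commutativeSemigroup xor-∧-commutativeRing) using (interchange)
open ≡-Reasoning

private
  variable
    A B : Set

≡ᵇ-refl : ∀ n → (n ≡ᵇ n) ≡ true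
≡ᵇ-refl n = dec-true (n ≟ n) refl

≢⇒≡ᵇ-false : ∀ {m n} → m ≢ n → (m ≡ᵇ n) ≡ false
≢⇒≡ᵇ-false {m} {n} = dec-false (m ≟ n)

<⇒<ᵇ-true : ∀ {m n} → m < n → (m <ᵇ n) ≡ true
<⇒<ᵇ-true {m} {n} = dec-true (m <? n)

≮⇒<ᵇ-false : ∀ {m n} → ¬ m < n → (m <ᵇ n) ≡ false
≮⇒<ᵇ-false {m} {n} = dec-false (m <? n)

-- Counting modulo 2

odd : ℕ → Bool
odd zero    = false
odd (suc n) = not (odd n)

odd-+ : ∀ m n → odd (m + n) ≡ odd m xor odd n
odd-+ zero    n = refl
odd-+ (suc m) n = trans (cong not (odd-+ m n)) (not-distribˡ-xor (odd m) (odd n))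

%2≡odd : ∀ n → n % 2 ≡ (if odd n then 1 else 0)
%2≡odd zero          = refl
%2≡odd (suc zero)    = refl
%2≡odd (suc (suc n)) rewrite not-involutive (odd n) = %2≡odd n

xorSum : (A → Bool) → List A → Bool
xorSum g []       = false
xorSum g (a ∷ as) = g a xor xorSum g as

xorSum-++ : ∀ (g : A → Bool) xs ys → xorSum g (xs ++ ys) ≡ xorSum g xs xor xorSum g ys
xorSum-++ g []       ys = refl
xorSum-++ g (x ∷ xs) ys = trans (cong (g x xor_) (xorSum-++ g xs ys)) (sym (xor-assoc (g x) _ _))

xorSum-map : ∀ (g : B → Bool) (h : A → B) xs → xorSum g (map h xs) ≡ xorSum (g ∘ h) xs
xorSum-map g h []       = refl
xorSum-map g h (x ∷ xs) = cong (g (h x) xor_) (xorSum-map g h xs)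

xorSum-concatMap : ∀ (g : B → Bool) (h : A → List B) xs →
  xorSum g (concatMap h xs) ≡ xorSum (xorSum g ∘ h) xs
xorSum-concatMap g h []       = refl
xorSum-concatMap g h (x ∷ xs) =
  trans (xorSum-++ g (h x) (concatMap h xs)) (cong (xorSum g (h x) xor_) (xorSum-concatMap g h xs))

xorSum-filterᵇ : ∀ (g p : A → Bool) xs → xorSum g (filterᵇ p xs) ≡ xorSum (λ a → p a ∧ g a) xs
xorSum-filterᵇ g p []       = refl
xorSum-filterᵇ g p (x ∷ xs) with p x
... | true  = cong (g x xor_) (xorSum-filterᵇ g p xs)
... | false = xorSum-filterᵇ g p xs

xorSum-xor : ∀ (g h : A → Bool) xs → xorSum g xs xor xorSum h xs ≡ xorSum (λ a → g a xor h a) xs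
xorSum-xor g h []       = refl
xorSum-xor g h (x ∷ xs) =
  trans (interchange (g x) (xorSum g xs) (h x) (xorSum h xs)) (cong ((g x xor h x) xor_) (xorSum-xor g h xs))

xorSum-cong : ∀ {g h : A → Bool} xs → (∀ a → g a ≡ h a) → xorSum g xs ≡ xorSum h xs
xorSum-cong []       g≗h = refl
xorSum-cong (x ∷ xs) g≗h = cong₂ _xor_ (g≗h x) (xorSum-cong xs g≗h)

xorSum-congᴬ : ∀ {P : A → Set} {g h : A → Bool} {xs} →
  All P xs → (∀ {a} → P a → g a ≡ h a) → xorSum g xs ≡ xorSum h xs
xorSum-congᴬ []         g≗h = refl
xorSum-congᴬ (px ∷ pxs) g≗h = cong₂ _xor_ (g≗h px) (xorSum-congᴬ pxs g≗h)

xorSum-false : ∀ {g : A → Bool} xs → (∀ a → g a ≡ false) → xorSum g xs ≡ false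
xorSum-false []       g≡false = refl
xorSum-false (x ∷ xs) g≡false rewrite g≡false x = xorSum-false xs g≡false

odd-sum : ∀ (f : A → ℕ) xs → odd (sum (map f xs)) ≡ xorSum (odd ∘ f) xs
odd-sum f []       = refl
odd-sum f (x ∷ xs) = trans (odd-+ (f x) (sum (map f xs))) (cong (odd (f x) xor_) (odd-sum f xs))

xorSum-upTo-single : ∀ (q : ℕ → Bool) c → (∀ k → k ≢ c → q k ≡ false) →
  ∀ N → xorSum q (upTo N) ≡ (c <ᵇ N) ∧ q c
xorSum-upTo-single q c q≡false zero    = refl
xorSum-upTo-single q c q≡false (suc N) = begin
  xorSum q (upTo (suc N))                ≡⟨ cong (xorSum q) (applyUpTo-∷ʳ id N) ⟨
  xorSum q (upTo N ++ N ∷ [])            ≡⟨ xorSum-++ q (upTo N) (N ∷ []) ⟩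
  xorSum q (upTo N) xor (q N xor false)  ≡⟨ cong₂ _xor_ (xorSum-upTo-single q c q≡false N) (xor-identityʳ (q N)) ⟩
  ((c <ᵇ N) ∧ q c) xor q N               ≡⟨ extend (N ≟ c) ⟩
  (c <ᵇ suc N) ∧ q c                     ∎
  where
  extend : Dec (N ≡ c) → ((c <ᵇ N) ∧ q c) xor q N ≡ (c <ᵇ suc N) ∧ q c
  extend (yes refl) rewrite ≮⇒<ᵇ-false (<-irrefl {c} refl) | <⇒<ᵇ-true (n<1+n c) = refl
  extend (no N≢c) rewrite q≡false N N≢c =
    trans (xor-identityʳ _)
      (cong (_∧ q c) (does-⇔ (mk⇔ m<n⇒m<1+n (λ c≤N → ≤∧≢⇒< (≤-pred c≤N) (N≢c ∘ sym)))
                             (c <? N) (c <? suc N)))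

-- Triangular numbers

triangular : ℕ → ℕ
triangular zero    = 0
triangular (suc j) = suc j + triangular j

*-triangular : ∀ j → 2 * triangular j ≡ j * suc j
*-triangular zero    = refl
*-triangular (suc j) = begin
  2 * (suc j + triangular j)        ≡⟨ *-distribˡ-+ 2 (suc j) (triangular j) ⟩
  2 * suc j + 2 * triangular j      ≡⟨ cong (2 * suc j +_) (*-triangular j) ⟩
  2 * suc j + j * suc j             ≡⟨ *-distribʳ-+ (suc j) 2 j ⟨
  (2 + j) * suc j                   ≡⟨ *-comm (2 + j) (suc j) ⟩
  suc j * suc (suc j)               ∎

triangular-strictMono : ∀ {a b} → a < b → triangular a < triangular b
triangular-strictMono {a} {suc b} (s≤s a≤b) with m≤n⇒m<n∨m≡n a≤b
... | inj₁ a<b  = <-trans (triangular-strictMono a<b) (s≤s (m≤n+m (triangular b) b))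
... | inj₂ refl = s≤s (m≤n+m (triangular a) a)

triangular-injective : ∀ {a b} → triangular a ≡ triangular b → a ≡ b
triangular-injective {a} {b} eq with <-cmp a b
... | tri< a<b _ _ = ⊥-elim (<⇒≢ (triangular-strictMono a<b) eq)
... | tri≈ _ a≡b _ = a≡b
... | tri> _ _ b<a = ⊥-elim (>⇒≢ (triangular-strictMono b<a) eq)

<ᵇ-∧-∸-≡ᵇ : ∀ m k t → (k <ᵇ suc m) ∧ (m ∸ k ≡ᵇ t) ≡ (m ≡ᵇ k + t)
<ᵇ-∧-∸-≡ᵇ m k t with k ≤? m
... | yes k≤m rewrite <⇒<ᵇ-true (s≤s k≤m) =
  does-⇔ (mk⇔ (λ e → trans (sym (m+[n∸m]≡n k≤m)) (cong (k +_) e))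
              (λ e → trans (cong (_∸ k) e) (m+n∸m≡n k t)))
         (m ∸ k ≟ t) (m ≟ k + t)
... | no k≰m rewrite ≮⇒<ᵇ-false (k≰m ∘ ≤-pred) =
  sym (≢⇒≡ᵇ-false (λ m≡k+t → k≰m (subst (k ≤_) (sym m≡k+t) (m≤m+n k t))))

firstPartFits : ℕ → ℕ → ℕ → Bool
firstPartFits m B k = (suc k ≤ᵇ B) ∧ (suc k ≤ᵇ suc m)

overlineΔ : (List Part → Bool) → ℕ → List Part → Bool
overlineΔ g v π = g ((v , false) ∷ π) xor g ((v , true) ∷ π)

xorSum-prependEither : ∀ (g : List Part → Bool) v S →
  xorSum g (concatMap (λ b → map ((v , b) ∷_) S) (false ∷ true ∷ [])) ≡ xorSum (overlineΔ g v) S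
xorSum-prependEither g v S = begin
  xorSum g (concatMap (λ b → map ((v , b) ∷_) S) (false ∷ true ∷ []))
    ≡⟨ xorSum-concatMap g (λ b → map ((v , b) ∷_) S) (false ∷ true ∷ []) ⟩
  xorSum g (map ((v , false) ∷_) S) xor (xorSum g (map ((v , true) ∷_) S) xor false)
    ≡⟨ cong (xorSum g (map ((v , false) ∷_) S) xor_) (xor-identityʳ _) ⟩
  xorSum g (map ((v , false) ∷_) S) xor xorSum g (map ((v , true) ∷_) S)
    ≡⟨ cong₂ _xor_ (xorSum-map g _ S) (xorSum-map g _ S) ⟩
  xorSum (g ∘ ((v , false) ∷_)) S xor xorSum (g ∘ ((v , true) ∷_)) S
    ≡⟨ xorSum-xor _ _ S ⟩
  xorSum (overlineΔ g v) S ∎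

xorSum-seqs : ∀ (g : List Part → Bool) f B m → xorSum g (seqs (suc f) B (suc m)) ≡
  xorSum (λ k → firstPartFits m B k ∧ xorSum (overlineΔ g (suc k)) (seqs f (suc k) (m ∸ k))) (upTo (suc m))
xorSum-seqs g f B m =
  trans (xorSum-concatMap g _ (filterᵇ (firstPartFits m B) (upTo (suc m))))
  (trans (xorSum-filterᵇ _ (firstPartFits m B) (upTo (suc m)))
  (xorSum-cong (upTo (suc m)) λ k →
    cong (firstPartFits m B k ∧_) (xorSum-prependEither g (suc k) (seqs f (suc k) (m ∸ k)))))

PartsAtMost : ℕ → List Part → Set
PartsAtMost B = All ((_≤ B) ∘ proj₁)

seqs-bounded : ∀ f B m → All (PartsAtMost B) (seqs f B m)
seqs-bounded zero    B zero    = [] ∷ []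
seqs-bounded zero    B (suc m) = []
seqs-bounded (suc f) B zero    = [] ∷ []
seqs-bounded (suc f) B (suc m) =
  concat⁺ (map⁺ (All.map withFirstPart (all-filter (T? ∘ firstPartFits m B) (upTo (suc m)))))
  where
  withFirstPart : ∀ {k} → T (firstPartFits m B k) →
    All (PartsAtMost B) (concatMap (λ b → map ((suc k , b) ∷_) (seqs f (suc k) (m ∸ k))) (false ∷ true ∷ []))
  withFirstPart {k} fits = concat⁺ (prepend false ∷ prepend true ∷ [])
    where
    k<B : suc k ≤ B
    k<B = ≤ᵇ⇒≤ (suc k) B (proj₁ (Equivalence.to T-∧ fits))
    prepend : ∀ b → All (PartsAtMost B) (map ((suc k , b) ∷_) (seqs f (suc k) (m ∸ k)))
    prepend b = map⁺ (All.map (λ ps → k<B ∷ All.map (λ p≤k → ≤-trans p≤k k<B) ps)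
                              (seqs-bounded f (suc k) (m ∸ k)))

occursNonOver-cons-≢ : ∀ {j v} π → j ≢ v → occursNonOver j ((v , false) ∷ π) ≡ occursNonOver j π
occursNonOver-cons-≢ π j≢v rewrite ≢⇒≡ᵇ-false j≢v = refl

occursNonOver-bounded : ∀ {j B} π → B < j → PartsAtMost B π → occursNonOver j π ≡ false
occursNonOver-bounded []               B<j []          = refl
occursNonOver-bounded ((v , false) ∷ π) B<j (v≤B ∷ bnd) =
  trans (occursNonOver-cons-≢ π (>⇒≢ (≤-<-trans v≤B B<j))) (occursNonOver-bounded π B<j bnd)
occursNonOver-bounded ((v , true)  ∷ π) B<j (_   ∷ bnd) = occursNonOver-bounded π B<j bnd

any-≡ᵇ-below : ∀ {n} xs → All (n <_) xs → any (n ≡ᵇ_) xs ≡ false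
any-≡ᵇ-below []       []             = refl
any-≡ᵇ-below (x ∷ xs) (n<x ∷ xs>n) rewrite ≢⇒≡ᵇ-false (<⇒≢ n<x) = any-≡ᵇ-below xs xs>n

-- The mex search

mexFrom-step : ∀ F k π →
  mexFrom (suc F) k π ≡ (if occursNonOver k π then mexFrom F (suc k) π else k)
mexFrom-step F k π with occursNonOver k π
... | true  = refl
... | false = refl

mexFrom-gap : ∀ F k π → occursNonOver k π ≡ false → mexFrom F k π ≡ k
mexFrom-gap zero    k π _   = refl
mexFrom-gap (suc F) k π k∉π rewrite mexFrom-step F k π | k∉π = refl

mexFrom-overlined : ∀ F k v π → mexFrom F k ((v , true) ∷ π) ≡ mexFrom F k π
mexFrom-overlined zero    k v π = refl
mexFrom-overlined (suc F) k v π
  rewrite mexFrom-step F k ((v , true) ∷ π) | mexFrom-step F k π | mexFrom-overlined F (suc k) v π = refl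

mexFrom-below : ∀ F k v π → v < k → mexFrom F k ((v , false) ∷ π) ≡ mexFrom F k π
mexFrom-below zero    k v π v<k = refl
mexFrom-below (suc F) k v π v<k
  rewrite mexFrom-step F k ((v , false) ∷ π) | mexFrom-step F k π | occursNonOver-cons-≢ π (>⇒≢ v<k)
        | mexFrom-below F (suc k) v π (m<n⇒m<1+n v<k) = refl

-- stopsAt F k v π: the search mexFrom F k π ends at the missing value v, before the fuel runs out.
stopsAt : ℕ → ℕ → ℕ → List Part → Bool
stopsAt zero    k v π = false
stopsAt (suc F) k v π =
  if k ≡ᵇ v then not (occursNonOver v π) else occursNonOver k π ∧ stopsAt F (suc k) v π

odd-mexFrom-cons : ∀ F k v π → occursNonOver (suc v) π ≡ false →
  odd (mexFrom F k ((v , false) ∷ π)) xor odd (mexFrom F k π) ≡ stopsAt F k v π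
odd-mexFrom-cons zero    k v π _ = xor-same (odd k)
odd-mexFrom-cons (suc F) k v π v+1∉π
  rewrite mexFrom-step F k ((v , false) ∷ π) | mexFrom-step F k π with k ≟ v
... | no k≢v rewrite ≢⇒≡ᵇ-false k≢v with occursNonOver k π
...   | true  = odd-mexFrom-cons F (suc k) v π v+1∉π
...   | false = xor-same (odd k)
odd-mexFrom-cons (suc F) k v π v+1∉π | yes refl rewrite ≡ᵇ-refl k with occursNonOver k π
...   | true  rewrite mexFrom-below F (suc k) k π (n<1+n k) = xor-same (odd (mexFrom F (suc k) π))
...   | false rewrite mexFrom-gap F (suc k) ((k , false) ∷ π)
                        (trans (occursNonOver-cons-≢ π (<⇒≢ (n<1+n k) ∘ sym)) v+1∉π) = xor-inverseˡ (odd k)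

stopsAt-occurs : ∀ F k v π → occursNonOver v π ≡ true → stopsAt F k v π ≡ false
stopsAt-occurs zero    k v π _   = refl
stopsAt-occurs (suc F) k v π v∈π with k ≡ᵇ v
... | true  rewrite v∈π = refl
... | false rewrite stopsAt-occurs F (suc k) v π v∈π = ∧-zeroʳ _

stopsAt-beyondGap : ∀ F k j v π → k ≤ j → j < v → occursNonOver j π ≡ false → stopsAt F k v π ≡ false
stopsAt-beyondGap zero    k j v π _   _   _   = refl
stopsAt-beyondGap (suc F) k j v π k≤j j<v j∉π
  rewrite ≢⇒≡ᵇ-false (<⇒≢ (≤-<-trans k≤j j<v)) with m≤n⇒m<n∨m≡n k≤j
... | inj₂ refl rewrite j∉π = refl
... | inj₁ k<j  rewrite stopsAt-beyondGap F (suc k) j v π k<j j<v j∉π = ∧-zeroʳ _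

stopsAt-step-≢ : ∀ F {k v} π → k ≢ v → stopsAt (suc F) k v π ≡ occursNonOver k π ∧ stopsAt F (suc k) v π
stopsAt-step-≢ F π k≢v rewrite ≢⇒≡ᵇ-false k≢v = refl

stopsAt-cons : ∀ F k u π → occursNonOver (suc u) π ≡ false → k ≤ u →
  stopsAt (suc F) k (suc u) ((u , false) ∷ π) xor stopsAt (suc F) k (suc u) ((u , true) ∷ π)
    ≡ stopsAt F k u π
stopsAt-cons zero k u π _ k≤u =
  cong₂ _xor_ (trans (stopsAt-step-≢ 0 ((u , false) ∷ π) k≢u+1) (∧-zeroʳ _))
              (trans (stopsAt-step-≢ 0 ((u , true) ∷ π) k≢u+1) (∧-zeroʳ _))
  where k≢u+1 = <⇒≢ (s≤s k≤u)
stopsAt-cons (suc F) k u π u+1∉π k≤u with k ≟ u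
... | yes refl
  rewrite ≢⇒≡ᵇ-false (<⇒≢ (n<1+n k)) | ≡ᵇ-refl k | ≢⇒≡ᵇ-false (<⇒≢ (n<1+n k) ∘ sym) | u+1∉π =
  trans (true-xor _) (cong not (∧-identityʳ _))
... | no k≢u = begin
  stopsAt (suc (suc F)) k (suc u) ((u , false) ∷ π) xor stopsAt (suc (suc F)) k (suc u) ((u , true) ∷ π)
    ≡⟨ cong₂ _xor_ (stopsAt-step-≢ (suc F) _ k≢u+1) (stopsAt-step-≢ (suc F) _ k≢u+1) ⟩
  (occursNonOver k ((u , false) ∷ π) ∧ plain) xor (occursNonOver k π ∧ barred)
    ≡⟨ cong (λ b → (b ∧ plain) xor (occursNonOver k π ∧ barred)) (occursNonOver-cons-≢ π k≢u) ⟩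
  (occursNonOver k π ∧ plain) xor (occursNonOver k π ∧ barred)
    ≡⟨ ∧-distribˡ-xor (occursNonOver k π) plain barred ⟨
  occursNonOver k π ∧ (plain xor barred)
    ≡⟨ cong (occursNonOver k π ∧_) (stopsAt-cons F (suc k) u π u+1∉π (≤∧≢⇒< k≤u k≢u)) ⟩
  occursNonOver k π ∧ stopsAt F (suc k) u π
    ≡⟨ stopsAt-step-≢ F π k≢u ⟨
  stopsAt (suc F) k u π ∎
  where
  k≢u+1 = <⇒≢ (s≤s k≤u)
  plain  = stopsAt (suc F) (suc k) (suc u) ((u , false) ∷ π)
  barred = stopsAt (suc F) (suc k) (suc u) ((u , true) ∷ π)

-- π may follow the parts s and has mex u + 1; the fuel 2 + length π is what omex grants once one
-- part is put in front of π.
mexTail : List ℕ → ℕ → List Part → Bool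
mexTail s u π = overlineOK s π ∧ stopsAt (2 + length π) 1 (suc u) π

overlineΔ-omex : ∀ k {π} → PartsAtMost (suc k) π →
  overlineΔ (λ ρ → overlineOK [] ρ ∧ odd (omex ρ)) (suc k) π ≡ mexTail (suc k ∷ []) k π
overlineΔ-omex k {π} bnd = begin
  (ok ∧ odd (mexFrom F 1 ((suc k , false) ∷ π))) xor (ok ∧ odd (mexFrom F 1 ((suc k , true) ∷ π)))
    ≡⟨ cong (λ x → (ok ∧ odd (mexFrom F 1 ((suc k , false) ∷ π))) xor (ok ∧ odd x))
            (mexFrom-overlined F 1 (suc k) π) ⟩
  (ok ∧ odd (mexFrom F 1 ((suc k , false) ∷ π))) xor (ok ∧ odd (mexFrom F 1 π))
    ≡⟨ ∧-distribˡ-xor ok _ _ ⟨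
  ok ∧ (odd (mexFrom F 1 ((suc k , false) ∷ π)) xor odd (mexFrom F 1 π))
    ≡⟨ cong (ok ∧_) (odd-mexFrom-cons F 1 (suc k) π (occursNonOver-bounded π (n<1+n (suc k)) bnd)) ⟩
  ok ∧ stopsAt F 1 (suc k) π ∎
  where
  ok = overlineOK (suc k ∷ []) π
  F  = 2 + length π

overlineΔ-top : ∀ s u π → overlineΔ (mexTail (suc u ∷ s) u) (suc u) π ≡ false
overlineΔ-top s u π = cong₂ _xor_ plainStopsLater barredForbidden
  where
  plainStopsLater : mexTail (suc u ∷ s) u ((suc u , false) ∷ π) ≡ false
  plainStopsLater =
    trans (cong (overlineOK (suc u ∷ suc u ∷ s) π ∧_)
                (stopsAt-occurs (3 + length π) 1 (suc u) ((suc u , false) ∷ π)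
                                (cong (_∨ occursNonOver (suc u) π) (≡ᵇ-refl u))))
          (∧-zeroʳ _)
  barredForbidden : mexTail (suc u ∷ s) u ((suc u , true) ∷ π) ≡ false
  barredForbidden rewrite ≡ᵇ-refl u = refl

overlineΔ-below : ∀ s u k {π} → suc k < u → PartsAtMost (suc k) π → overlineΔ (mexTail s u) (suc k) π ≡ false
overlineΔ-below s u k {π} k+1<u bnd = cong₂ _xor_ (missesU false) (missesU true)
  where
  missesU : ∀ b → mexTail s u ((suc k , b) ∷ π) ≡ false
  missesU b =
    trans (cong (overlineOK s ((suc k , b) ∷ π) ∧_)
                (stopsAt-beyondGap (3 + length π) 1 u (suc u) ((suc k , b) ∷ π) (≤-trans (s≤s z≤n) k+1<u) (n<1+n u)
                                   (occursNonOver-bounded ((suc k , b) ∷ π) k+1<u (≤-refl ∷ bnd))))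
          (∧-zeroʳ _)

overlineΔ-next : ∀ s k {π} → All (suc k <_) s → PartsAtMost (suc k) π →
  overlineΔ (mexTail s (suc k)) (suc k) π ≡ mexTail (suc k ∷ s) k π
overlineΔ-next s k {π} s>k+1 bnd = begin
  (ok ∧ plain) xor ((not (any (suc k ≡ᵇ_) s) ∧ ok) ∧ barred)
    ≡⟨ cong (λ b → (ok ∧ plain) xor ((not b ∧ ok) ∧ barred)) (any-≡ᵇ-below s s>k+1) ⟩
  (ok ∧ plain) xor (ok ∧ barred)
    ≡⟨ ∧-distribˡ-xor ok plain barred ⟨
  ok ∧ (plain xor barred)
    ≡⟨ cong (ok ∧_) (stopsAt-cons (2 + length π) 1 (suc k) π
                                  (occursNonOver-bounded π (n<1+n (suc k)) bnd) (s≤s z≤n)) ⟩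
  ok ∧ stopsAt (2 + length π) 1 (suc k) π ∎
  where
  ok     = overlineOK (suc k ∷ s) π
  plain  = stopsAt (3 + length π) 1 (2 + k) ((suc k , false) ∷ π)
  barred = stopsAt (3 + length π) 1 (2 + k) ((suc k , true) ∷ π)

-- Tails of prescribed mex

firstPartTerm : ℕ → ℕ → List ℕ → ℕ → ℕ → Bool
firstPartTerm f m s u k = xorSum (overlineΔ (mexTail s u) (suc k)) (seqs f (suc k) (m ∸ k))

firstPartTerm-top : ∀ f m s u → firstPartTerm f m (suc u ∷ s) u u ≡ false
firstPartTerm-top f m s u = xorSum-false (seqs f (suc u) (m ∸ u)) (overlineΔ-top s u)

firstPartTerm-below : ∀ f m s u k → suc k < u → firstPartTerm f m s u k ≡ false
firstPartTerm-below f m s u k k+1<u =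
  trans (xorSum-congᴬ (seqs-bounded f (suc k) (m ∸ k)) (overlineΔ-below s u k k+1<u))
        (xorSum-false (seqs f (suc k) (m ∸ k)) λ _ → refl)

firstPartTerm-next : ∀ f m s k → All (suc k <_) s →
  firstPartTerm f m s (suc k) k ≡ xorSum (mexTail (suc k ∷ s) k) (seqs f (suc k) (m ∸ k))
firstPartTerm-next f m s k s>k+1 = xorSum-congᴬ (seqs-bounded f (suc k) (m ∸ k)) (overlineΔ-next s k s>k+1)

xorSum-mexTail : ∀ f u m s → m ≤ f → All (suc u <_) s →
  xorSum (mexTail (suc u ∷ s) u) (seqs f (suc u) m) ≡ (m ≡ᵇ triangular u)
xorSum-mexTail zero    zero    zero s _ _ = refl
xorSum-mexTail zero    (suc u) zero s _ _ = refl
xorSum-mexTail (suc f) zero    zero s _ _ = refl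
xorSum-mexTail (suc f) (suc u) zero s _ _ = refl
xorSum-mexTail (suc f) zero (suc m) s _ _ =
  trans (xorSum-seqs (mexTail (1 ∷ s) 0) f 1 m) (xorSum-false (upTo (suc m)) onlyTop)
  where
  onlyTop : ∀ k → firstPartFits m 1 k ∧ firstPartTerm f m (1 ∷ s) 0 k ≡ false
  onlyTop zero    = trans (cong (firstPartFits m 1 0 ∧_) (firstPartTerm-top f m s 0)) (∧-zeroʳ (firstPartFits m 1 0))
  onlyTop (suc k) = refl
xorSum-mexTail (suc f) (suc u) (suc m) s (s≤s m≤f) s>u+2 = begin
  xorSum (mexTail (2 + u ∷ s) (suc u)) (seqs (suc f) (2 + u) (suc m))
    ≡⟨ xorSum-seqs (mexTail (2 + u ∷ s) (suc u)) f (2 + u) m ⟩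
  xorSum (λ k → firstPartFits m (2 + u) k ∧ term k) (upTo (suc m))
    ≡⟨ xorSum-upTo-single _ u onlyNext (suc m) ⟩
  a ∧ (((u <ᵇ 2 + u) ∧ a) ∧ term u)
    ≡⟨ cong₂ (λ b x → a ∧ ((b ∧ a) ∧ x)) (<⇒<ᵇ-true (m<n⇒m<1+n (n<1+n u))) next ⟩
  a ∧ (a ∧ (m ∸ u ≡ᵇ triangular u))
    ≡⟨ ∧-assoc a a _ ⟨
  (a ∧ a) ∧ (m ∸ u ≡ᵇ triangular u)
    ≡⟨ cong (_∧ (m ∸ u ≡ᵇ triangular u)) (∧-idem a) ⟩
  a ∧ (m ∸ u ≡ᵇ triangular u)
    ≡⟨ <ᵇ-∧-∸-≡ᵇ m u (triangular u) ⟩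
  (m ≡ᵇ u + triangular u) ∎
  where
  a    = u <ᵇ suc m
  term = firstPartTerm f m (2 + u ∷ s) (suc u)
  s′>u+1 : All (suc u <_) (2 + u ∷ s)
  s′>u+1 = n<1+n (suc u) ∷ All.map (<-trans (n<1+n (suc u))) s>u+2
  next : term u ≡ (m ∸ u ≡ᵇ triangular u)
  next = trans (firstPartTerm-next f m (2 + u ∷ s) u s′>u+1)
               (xorSum-mexTail f u (m ∸ u) (2 + u ∷ s) (≤-trans (m∸n≤m m u) m≤f) s′>u+1)
  onlyNext : ∀ k → k ≢ u → firstPartFits m (2 + u) k ∧ term k ≡ false
  onlyNext k k≢u with <-cmp k u
  ... | tri< k<u _ _ =
    trans (cong (firstPartFits m (2 + u) k ∧_) (firstPartTerm-below f m _ (suc u) k (s≤s k<u))) (∧-zeroʳ _)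
  ... | tri≈ _ k≡u _ = ⊥-elim (k≢u k≡u)
  ... | tri> _ _ u<k with m≤n⇒m<n∨m≡n u<k
  ...   | inj₂ refl  = trans (cong (firstPartFits m (2 + u) (suc u) ∧_) (firstPartTerm-top f m s (suc u))) (∧-zeroʳ _)
  ...   | inj₁ u+1<k rewrite ≮⇒<ᵇ-false (<⇒≱ u+1<k ∘ ≤-pred) = refl

odd-σomex : ∀ m → odd (σomex (suc m)) ≡ xorSum (λ k → suc m ≡ᵇ triangular (suc k)) (upTo (suc m))
odd-σomex m = begin
  odd (σomex (suc m))
    ≡⟨ odd-sum omex (overpartitions (suc m)) ⟩
  xorSum (odd ∘ omex) (overpartitions (suc m))
    ≡⟨ xorSum-filterᵇ (odd ∘ omex) (overlineOK []) (seqs (suc m) (suc m) (suc m)) ⟩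
  xorSum g (seqs (suc m) (suc m) (suc m))
    ≡⟨ xorSum-seqs g m (suc m) m ⟩
  xorSum (λ k → firstPartFits m (suc m) k ∧ xorSum (overlineΔ g (suc k)) (seqs m (suc k) (m ∸ k))) (upTo (suc m))
    ≡⟨ xorSum-cong (upTo (suc m)) (λ k → cong (firstPartFits m (suc m) k ∧_) (tails k)) ⟩
  xorSum (λ k → firstPartFits m (suc m) k ∧ (m ∸ k ≡ᵇ triangular k)) (upTo (suc m))
    ≡⟨ xorSum-cong (upTo (suc m)) (λ k →
         trans (cong (_∧ (m ∸ k ≡ᵇ triangular k)) (∧-idem (k <ᵇ suc m))) (<ᵇ-∧-∸-≡ᵇ m k (triangular k))) ⟩
  xorSum (λ k → suc m ≡ᵇ triangular (suc k)) (upTo (suc m)) ∎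
  where
  g : List Part → Bool
  g π = overlineOK [] π ∧ odd (omex π)
  tails : ∀ k → xorSum (overlineΔ g (suc k)) (seqs m (suc k) (m ∸ k)) ≡ (m ∸ k ≡ᵇ triangular k)
  tails k = trans (xorSum-congᴬ (seqs-bounded m (suc k) (m ∸ k)) (overlineΔ-omex k))
                  (xorSum-mexTail m k (m ∸ k) [] (m∸n≤m m k) [])

odd-σomex-triangular : ∀ m j → 2 * suc m ≡ j * suc j → odd (σomex (suc m)) ≡ true
odd-σomex-triangular m zero    ()
odd-σomex-triangular m (suc c) eq =
  trans (odd-σomex m) (trans (xorSum-upTo-single _ c onlyAtC (suc m))
                             (cong₂ _∧_ (<⇒<ᵇ-true c<n) (dec-true (suc m ≟ triangular (suc c)) n≡)))
  where
  n≡ : suc m ≡ triangular (suc c)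
  n≡ = *-cancelˡ-≡ (suc m) (triangular (suc c)) 2 (trans eq (sym (*-triangular (suc c))))
  c<n : c < suc m
  c<n = subst (c <_) (sym n≡) (s≤s (m≤m+n c (triangular c)))
  onlyAtC : ∀ k → k ≢ c → (suc m ≡ᵇ triangular (suc k)) ≡ false
  onlyAtC k k≢c = ≢⇒≡ᵇ-false (λ e → k≢c (suc-injective (triangular-injective (trans (sym e) n≡))))

odd-σomex-nonTriangular : ∀ m → ¬ (∃[ j ] 2 * suc m ≡ j * suc j) → odd (σomex (suc m)) ≡ false
odd-σomex-nonTriangular m nonTriangular =
  trans (odd-σomex m) (xorSum-false (upTo (suc m)) λ k →
    ≢⇒≡ᵇ-false {suc m} {triangular (suc k)}
      (λ e → nonTriangular (suc k , trans (cong (2 *_) e) (*-triangular (suc k)))))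

theorem1p3 : (n : ℕ) → 1 Data.Nat.≤ n →
    ((∃[ j ] 2 * n ≡ j * suc j) → σomex n % 2 ≡ 1) ×
    ((¬ (∃[ j ] 2 * n ≡ j * suc j)) → σomex n % 2 ≡ 0)
theorem1p3 (suc m) _ =
  (λ (j , eq) → trans (%2≡odd (σomex (suc m))) (cong (if_then 1 else 0) (odd-σomex-triangular m j eq))) ,
  (λ nonTriangular → trans (%2≡odd (σomex (suc m))) (cong (if_then 1 else 0) (odd-σomex-nonTriangular m nonTriangular)))
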